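{- Let $P=(X,\prec)$ be a finite poset with $n=|X|$ elements and let $x,y\in X$ with $x\prec y$. Let $F(k)$ be the number of linear extensions $L$ of $P$ with $L(y)-L(x)=k$. Then $F(k)>0$ if and only if $$h(x,y)<k<n-f(x)-g(y).$$
   Context: A linear extension of $P$ is a bijection $L:X\to\{1,\dots,n\}$ with $L(u)<L(v)$ whenever $u\prec v$. For $u\in X$, $f(u):=|\{v\in X:v\prec u\}|$, $g(u):=|\{v\in X:v\succ u\}|$, and for $u,w\in X$, $h(u,w):=|\{v\in X:u\prec v\prec w\}|$. -}

module Defs where

open import Data.Nat using (ℕ)
open import Data.Fin using (Fin; toℕ) renaming (_<_ to _<ᶠ_)
open import Data.List using (List; length; filter)
open import Data.List using () renaming (allFin to allFinL)
open import Data.Product using (_×_; _,_)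
open import Data.Integer using (ℤ; +_; _-_)
open import Relation.Binary using (Rel; Decidable)
open import Relation.Binary.PropositionalEquality using (_≡_)
open import Relation.Nullary using (Dec)
open import Relation.Nullary.Decidable using (_×-dec_)
open import Function using (Bijective)
open import Level using (0ℓ)

-- A finite poset with n elements: carrier Fin n, strict order _≺_.
-- Counting functions need the order to be decidable (automatic classically
-- for a finite poset).

module _ {n : ℕ} (_≺_ : Rel (Fin n) 0ℓ) (_≺?_ : Decidable _≺_) where

  f : Fin n → ℕ
  f u = length (filter (λ v → v ≺? u) (allFinL n))

  g : Fin n → ℕ
  g u = length (filter (λ v → u ≺? v) (allFinL n))

  h : Fin n → Fin n → ℕ
  h u w = length (filter (λ v → (u ≺? v) ×-dec (v ≺? w)) (allFinL n))

-- A linear extension: bijection L : X → {0,…,n-1} (positions shifted by one,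
-- which does not affect differences) with L u < L v whenever u ≺ v.
record LinearExtension {n : ℕ} (_≺_ : Rel (Fin n) 0ℓ) : Set where
  field
    L        : Fin n → Fin n
    bijective : Bijective _≡_ _≡_ L
    monotone : ∀ {u v} → u ≺ v → L u <ᶠ L v

open LinearExtension public

diff : {n : ℕ} {_≺_ : Rel (Fin n) 0ℓ} → LinearExtension _≺_ → Fin n → Fin n → ℤ
diff E x y = + toℕ (L E y) - + toℕ (L E x)

{-# OPTIONS --safe #-}
module Submission where

-- Necessity: in a linear extension every element below x precedes x, every element above y
-- follows y, and every element strictly between x and y lies between them.
--
-- Sufficiency: fix a linear extension `tiebreak` of P, with values below M. For a time t, the
-- lower block consists of the elements below x and those not above x whose tiebreak is < t; the
-- upper block consists of the elements above y and those above x but not below y whose tiebreak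
-- is ≥ 2M - t. Listing the lower block, x, the remaining elements, y, and the upper block (each
-- block in tiebreak order) is a linear extension in which L(y) - L(x) is one more than the size
-- of the middle. At t = 0 the middle has at least n - f(x) - g(y) - 2 elements, at t = 2M at
-- most h(x,y), and from t to t + 1 at most one element leaves it (the lower block grows only
-- while t < M, the upper block only afterwards), so every gap in between is attained.

open import Defs
open import Data.Bool.Base using (if_then_else_)
open import Data.Fin using (Fin; zero; suc; toℕ; fromℕ<; _≟_; punchOut; combine)
  renaming (_<_ to _<ᶠ_; _≤_ to _≤ᶠ_)
open import Data.Fin.Patterns using (0F; 1F; 2F; 3F; 4F)
open import Data.Fin.Properties
  using (any?; suc-injective; toℕ-fromℕ<; toℕ-injective; toℕ<n; injective⇒≤; punchOut-injective;
         combine-monoˡ-<; combine-injectiveʳ; toℕ-combine)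
  renaming (_<?_ to _<ᶠ?_; _≤?_ to _≤ᶠ?_)
open import Data.Integer as ℤ using (ℤ; +_; -_; _-_; _⊖_)
import Data.Integer.Properties as ℤₚ
open import Data.Integer.Tactic.RingSolver using () renaming (solve-∀ to ℤ-solve-∀)
open import Data.List using (length; filter; tabulate)
open import Data.Nat as ℕ using (ℕ; zero; suc; _+_; _*_; _∸_; _≤_; _<_; z≤n; s≤s; _≤?_; _<?_)
open import Data.Nat.Properties hiding (_≟_; _≤?_; _<?_; suc-injective)
open import Data.Nat.Tactic.RingSolver using (solve-∀)
open import Algebra.Properties.CommutativeMonoid.Sum +-0-commutativeMonoid using (sum; sum-permute)
open import Data.Product using (Σ; _×_; _,_; proj₁; proj₂)
open import Data.Sum using (_⊎_; inj₁; inj₂)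
open import Function using (_∘_; id)
open import Function.Bundles using (_⇔_; mk⇔; mk⤖; Equivalence)
open import Function.Definitions using (Injective; Surjective; Bijective)
open import Function.Properties.Bijection using (⤖⇒↔)
open import Function.Properties.Equivalence using () renaming (trans to ⇔-trans; sym to ⇔-sym)
open import Level using (Level; 0ℓ)
open import Relation.Binary using (Rel; IsStrictPartialOrder; tri<; tri≈; tri>)
  renaming (Decidable to Decidable₂)
open import Relation.Binary.PropositionalEquality
open import Relation.Nullary using (¬_; yes; no; does; contradiction)
open import Relation.Nullary.Decidable using (_×-dec_; _⊎-dec_; ¬?; decidable-stable)
open import Relation.Unary using (Pred; Decidable; _⊆_)
open import Relation.Unary.Properties using (∅?; ∁?; _∩?_; _∪?_)

open Equivalence using (to; from)

private variable
  a p q : Level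
  A : Set a
  n : ℕ

count : {P : Pred (Fin n) p} → Decidable P → ℕ
count P? = sum λ i → if does (P? i) then 1 else 0

length-filter-tabulate : {R : Pred A p} (R? : Decidable R) (φ : Fin n → A) →
                         length (filter R? (tabulate φ)) ≡ count (R? ∘ φ)
length-filter-tabulate {n = zero}  R? φ = refl
length-filter-tabulate {n = suc n} R? φ with R? (φ zero)
... | yes _ = cong suc (length-filter-tabulate R? (φ ∘ suc))
... | no  _ = length-filter-tabulate R? (φ ∘ suc)

count-mono : ∀ {n} {P : Pred (Fin n) p} {Q : Pred (Fin n) q} (P? : Decidable P) (Q? : Decidable Q) →
             P ⊆ Q → count P? ≤ count Q?
count-mono {n = zero}  P? Q? P⊆Q = z≤n
count-mono {n = suc n} P? Q? P⊆Q with P? zero | Q? zero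
... | yes P0 | no ¬Q0 = contradiction (P⊆Q P0) ¬Q0
... | yes _  | yes _  = s≤s (count-mono (P? ∘ suc) (Q? ∘ suc) P⊆Q)
... | no _   | yes _  = m≤n⇒m≤1+n (count-mono (P? ∘ suc) (Q? ∘ suc) P⊆Q)
... | no _   | no _   = count-mono (P? ∘ suc) (Q? ∘ suc) P⊆Q

count-cong : ∀ {n} {P : Pred (Fin n) p} {Q : Pred (Fin n) q} (P? : Decidable P) (Q? : Decidable Q) →
             P ⊆ Q → Q ⊆ P → count P? ≡ count Q?
count-cong P? Q? P⊆Q Q⊆P = ≤-antisym (count-mono P? Q? P⊆Q) (count-mono Q? P? Q⊆P)

count-split : ∀ {n} {P : Pred (Fin n) p} {Q : Pred (Fin n) q} (P? : Decidable P) (Q? : Decidable Q) →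
              count P? ≡ count (P? ∩? Q?) + count (P? ∩? ∁? Q?)
count-split {n = zero}  P? Q? = refl
count-split {n = suc n} P? Q? with P? zero | Q? zero
... | yes _ | yes _ = cong suc (count-split (P? ∘ suc) (Q? ∘ suc))
... | yes _ | no _  = trans (cong suc (count-split (P? ∘ suc) (Q? ∘ suc))) (sym (+-suc _ _))
... | no _  | yes _ = count-split (P? ∘ suc) (Q? ∘ suc)
... | no _  | no _  = count-split (P? ∘ suc) (Q? ∘ suc)

count-complement : ∀ {n} {P : Pred (Fin n) p} (P? : Decidable P) → count P? + count (∁? P?) ≡ n
count-complement {n = zero}  P? = refl
count-complement {n = suc n} P? with P? zero
... | yes _ = cong suc (count-complement (P? ∘ suc))
... | no _  = trans (+-suc _ _) (cong suc (count-complement (P? ∘ suc)))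

count-≤ : ∀ {n} {P : Pred (Fin n) p} (P? : Decidable P) → count P? ≤ n
count-≤ P? = ≤-trans (m≤m+n _ _) (≤-reflexive (count-complement P?))

count-∪ : ∀ {n} {P : Pred (Fin n) p} {Q : Pred (Fin n) q} (P? : Decidable P) (Q? : Decidable Q) →
          count (P? ∪? Q?) ≤ count P? + count Q?
count-∪ {P = P} {Q = Q} P? Q? = begin
  count (P? ∪? Q?)                                        ≡⟨ count-split (P? ∪? Q?) P? ⟩
  count ((P? ∪? Q?) ∩? P?) + count ((P? ∪? Q?) ∩? ∁? P?)  ≤⟨ +-mono-≤ (count-mono ((P? ∪? Q?) ∩? P?) P? proj₂)
                                                                      (count-mono ((P? ∪? Q?) ∩? ∁? P?) Q? only-Q) ⟩
  count P? + count Q?                                     ∎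
  where
  open ≤-Reasoning
  only-Q : ∀ {i} → (P i ⊎ Q i) × ¬ P i → Q i
  only-Q (inj₁ Pi , ¬Pi) = contradiction Pi ¬Pi
  only-Q (inj₂ Qi , _)   = Qi

count-∅ : ∀ {n} → count (∅? {A = Fin n}) ≡ 0
count-∅ {zero}  = refl
count-∅ {suc n} = count-∅ {n}

count-singleton : (z : Fin n) → count (_≟ z) ≡ 1
count-singleton {n = suc n} zero =
  cong suc (trans (count-cong {n = n} (λ i → suc i ≟ zero) ∅? (λ ()) (λ ())) (count-∅ {n}))
count-singleton {n = suc n} (suc z) =
  trans (count-cong (λ i → suc i ≟ suc z) (_≟ z) suc-injective (cong suc)) (count-singleton z)

count-pos : ∀ {n} {P : Pred (Fin n) p} (P? : Decidable P) {z} → P z → 0 < count P?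
count-pos P? {z} Pz = ≤-trans (≤-reflexive (sym (count-singleton z))) (count-mono (_≟ z) P? λ { refl → Pz })

count-< : ∀ {n} {P : Pred (Fin n) p} (P? : Decidable P) {z} → ¬ P z → count P? < n
count-< {n = n} P? ¬Pz = begin-strict
  count P?                 <⟨ m<m+n _ (count-pos (∁? P?) ¬Pz) ⟩
  count P? + count (∁? P?) ≡⟨ count-complement P? ⟩
  n                        ∎
  where open ≤-Reasoning

count-strict : ∀ {n} {P : Pred (Fin n) p} {Q : Pred (Fin n) q} (P? : Decidable P) (Q? : Decidable Q) →
               P ⊆ Q → ∀ {z} → Q z → ¬ P z → count P? < count Q?
count-strict P? Q? P⊆Q Qz ¬Pz = begin-strict
  count P?                                ≡⟨ count-cong P? (Q? ∩? P?) (λ Pi → P⊆Q Pi , Pi) proj₂ ⟩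
  count (Q? ∩? P?)                        <⟨ m<m+n _ (count-pos (Q? ∩? ∁? P?) (Qz , ¬Pz)) ⟩
  count (Q? ∩? P?) + count (Q? ∩? ∁? P?)  ≡⟨ count-split Q? P? ⟨
  count Q?                                ∎
  where open ≤-Reasoning

count-≤1 : ∀ {n} {P : Pred (Fin n) p} (P? : Decidable P) → (∀ {i j} → P i → P j → i ≡ j) → count P? ≤ 1
count-≤1 {n = n} P? unique with any? P?
... | yes (z , Pz) = ≤-trans (count-mono P? (_≟ z) (λ Pi → unique Pi Pz)) (≤-reflexive (count-singleton z))
... | no ∄        = ≤-trans (count-mono P? ∅? (λ {i} Pi → ∄ (i , Pi))) (≤-trans (≤-reflexive (count-∅ {n})) z≤n)

count-permute : ∀ {n} {P : Pred (Fin n) p} (P? : Decidable P) {π : Fin n → Fin n} →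
                Bijective _≡_ _≡_ π → count (P? ∘ π) ≡ count P?
count-permute P? bij = sym (sum-permute _ (⤖⇒↔ (mk⤖ bij)))

count-toℕ-< : ∀ {m} → m ≤ n → count (λ (i : Fin n) → toℕ i <? m) ≡ m
count-toℕ-< {n = zero}  {zero}  _         = refl
count-toℕ-< {n = suc n} {zero}  _         = count-toℕ-< {n = n} z≤n
count-toℕ-< {n = suc n} {suc m} (s≤s m≤n) = cong suc (count-toℕ-< m≤n)

count-interval : ∀ {n a b} → a ≤ b → b ≤ n →
                 count (λ (i : Fin n) → (a ≤? toℕ i) ×-dec (toℕ i <? b)) + a ≡ b
count-interval {n} {a} {b} a≤b b≤n = begin
  count (a≤? ∩? <b?) + a                       ≡⟨ +-comm _ a ⟩
  a + count (a≤? ∩? <b?)                       ≡⟨ cong₂ _+_ (sym (count-toℕ-< (≤-trans a≤b b≤n)))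
                                                    (count-cong (a≤? ∩? <b?) (<b? ∩? ∁? <a?)
                                                      (λ (a≤i , i<b) → i<b , ≤⇒≯ a≤i)
                                                      (λ (i<b , i≮a) → ≮⇒≥ i≮a , i<b)) ⟩
  count <a? + count (<b? ∩? ∁? <a?)            ≡⟨ cong (_+ count (<b? ∩? ∁? <a?))
                                                    (count-cong <a? (<b? ∩? <a?)
                                                      (λ i<a → <-≤-trans i<a a≤b , i<a) proj₂) ⟩
  count (<b? ∩? <a?) + count (<b? ∩? ∁? <a?)   ≡⟨ count-split <b? <a? ⟨
  count <b?                                    ≡⟨ count-toℕ-< b≤n ⟩
  b                                            ∎
  where
  open ≡-Reasoning
  <a? : Decidable (λ (i : Fin n) → toℕ i < a)
  <a? i = toℕ i <? a
  <b? : Decidable (λ (i : Fin n) → toℕ i < b)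
  <b? i = toℕ i <? b
  a≤? : Decidable (λ (i : Fin n) → a ≤ toℕ i)
  a≤? i = a ≤? toℕ i

injective⇒surjective : ∀ {n} {φ : Fin n → Fin n} → Injective _≡_ _≡_ φ → Surjective _≡_ _≡_ φ
injective⇒surjective {suc n} {φ} φ-injective j with any? (λ i → φ i ≟ j)
... | yes (i , φi≡j) = i , λ { refl → φi≡j }
... | no ∄ = contradiction (injective⇒≤ {f = φ′} φ′-injective) (<-irrefl refl)
  where
  φ≢j : ∀ i → φ i ≢ j
  φ≢j i φi≡j = ∄ (i , φi≡j)
  φ′ : Fin (suc n) → Fin n
  φ′ i = punchOut (φ≢j i ∘ sym)
  φ′-injective : Injective _≡_ _≡_ φ′
  φ′-injective {u} {v} = φ-injective ∘ punchOut-injective (φ≢j u ∘ sym) (φ≢j v ∘ sym)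

combine-lex-< : ∀ {m k} {i j : Fin m} {a b : Fin k} → i ≤ᶠ j → (i ≡ j → a <ᶠ b) → combine i a <ᶠ combine j b
combine-lex-< {k = k} {i} {j} {a} {b} i≤j i≡j⇒a<b with m≤n⇒m<n∨m≡n i≤j
... | inj₁ i<j = combine-monoˡ-< a b i<j
... | inj₂ i≡j with refl ← toℕ-injective i≡j = begin-strict
  toℕ (combine i a)     ≡⟨ toℕ-combine i a ⟩
  k * toℕ i + toℕ a     <⟨ +-monoʳ-< (k * toℕ i) (i≡j⇒a<b refl) ⟩
  k * toℕ i + toℕ b     ≡⟨ toℕ-combine i b ⟨
  toℕ (combine i b)     ∎
  where open ≤-Reasoning

discrete-ivt : (F : ℕ → ℕ) → (∀ t → F t ≤ suc (F (suc t))) →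
               ∀ T {m} → F T ≤ m → m ≤ F 0 → Σ ℕ (λ t → F t ≡ m)
discrete-ivt F step zero    FT≤m m≤F0 = 0 , ≤-antisym FT≤m m≤F0
discrete-ivt F step (suc T) {m} FT≤m m≤F0 with F T ≤? m
... | yes FT≤m′ = discrete-ivt F step T FT≤m′ m≤F0
... | no  FT≰m  = suc T , ≤-antisym FT≤m (≤-pred (≤-trans (≰⇒> FT≰m) (step T)))

+[m+n]-+m≡+n : ∀ m n → + (m + n) - + m ≡ + n
+[m+n]-+m≡+n m n = begin
  + (m + n) - + m     ≡⟨ ℤₚ.m-n≡m⊖n (m + n) m ⟩
  (m + n) ⊖ m         ≡⟨ ℤₚ.⊖-≥ (m≤m+n m n) ⟩
  + (m + n ∸ m)       ≡⟨ cong +_ (m+n∸m≡n m n) ⟩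
  + n                 ∎
  where open ≡-Reasoning

k<i-j⇔k+j<i : ∀ {i j k : ℤ} → k ℤ.< i - j ⇔ k ℤ.+ j ℤ.< i
k<i-j⇔k+j<i {i} {j} {k} = mk⇔
  (λ k<i-j → subst (k ℤ.+ j ℤ.<_) (i-j+j≡i i j) (ℤₚ.+-monoˡ-< j k<i-j))
  (λ k+j<i → subst (ℤ._< i - j) (k+j-j≡k k j) (ℤₚ.+-monoˡ-< (- j) k+j<i))
  where
  i-j+j≡i : ∀ i j → i - j ℤ.+ j ≡ i
  i-j+j≡i = ℤ-solve-∀
  k+j-j≡k : ∀ k j → k ℤ.+ j - j ≡ k
  k+j-j≡k = ℤ-solve-∀

window-ℤ⇔ℕ : ∀ a b c {n k} →
             (+ a ℤ.< k × k ℤ.< + n - + b - + c) ⇔ Σ ℕ (λ m → k ≡ + m × a < m × m + c + b < n)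
window-ℤ⇔ℕ a b c = mk⇔
  (λ { (ℤ.+<+ a<m , k<n-b-c) →
         _ , refl , a<m , ℤₚ.drop‿+<+ (to (k<i-j⇔k+j<i {j = + b}) (to (k<i-j⇔k+j<i {j = + c}) k<n-b-c)) })
  (λ { (m , refl , a<m , m+c+b<n) →
         ℤ.+<+ a<m , from (k<i-j⇔k+j<i {j = + c}) (from (k<i-j⇔k+j<i {j = + b}) (ℤ.+<+ m+c+b<n)) })

module Ranking {n m : ℕ} {_≺_ : Rel (Fin n) 0ℓ} (K : Fin n → Fin m)
               (K-injective : Injective _≡_ _≡_ K) (K-mono : ∀ {u v} → u ≺ v → K u <ᶠ K v) where

  K<? : ∀ u → Decidable (λ w → K w <ᶠ K u)
  K<? u w = K w <ᶠ? K u

  K≤? : ∀ u → Decidable (λ w → K w ≤ᶠ K u)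
  K≤? u w = K w ≤ᶠ? K u

  K>? : ∀ u → Decidable (λ w → K u <ᶠ K w)
  K>? u w = K u <ᶠ? K w

  rank : Fin n → ℕ
  rank u = count (K<? u)

  rank<n : ∀ u → rank u < n
  rank<n u = count-< (K<? u) (<-irrefl refl)

  rank-mono : ∀ {u v} → K u <ᶠ K v → rank u < rank v
  rank-mono {u} {v} Ku<Kv =
    count-strict (K<? u) (K<? v) (λ Kw<Ku → <-trans Kw<Ku Ku<Kv) Ku<Kv (<-irrefl refl)

  rank-injective : ∀ {u v} → rank u ≡ rank v → u ≡ v
  rank-injective {u} {v} ru≡rv with <-cmp (toℕ (K u)) (toℕ (K v))
  ... | tri< Ku<Kv _ _ = contradiction ru≡rv (<⇒≢ (rank-mono Ku<Kv))
  ... | tri≈ _ Ku≡Kv _ = K-injective (toℕ-injective Ku≡Kv)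
  ... | tri> _ _ Kv<Ku = contradiction (sym ru≡rv) (<⇒≢ (rank-mono Kv<Ku))

  rankFin : Fin n → Fin n
  rankFin u = fromℕ< (rank<n u)

  toℕ-rankFin : ∀ u → toℕ (rankFin u) ≡ rank u
  toℕ-rankFin u = toℕ-fromℕ< (rank<n u)

  rankFin-injective : Injective _≡_ _≡_ rankFin
  rankFin-injective {u} {v} eq = rank-injective (begin
    rank u              ≡⟨ toℕ-rankFin u ⟨
    toℕ (rankFin u)     ≡⟨ cong toℕ eq ⟩
    toℕ (rankFin v)     ≡⟨ toℕ-rankFin v ⟩
    rank v              ∎)
    where open ≡-Reasoning

  rankExtension : LinearExtension _≺_
  rankExtension = record
    { L         = rankFin
    ; bijective = rankFin-injective , injective⇒surjective rankFin-injective
    ; monotone  = λ {u} {v} u≺v →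
                    subst₂ _<_ (sym (toℕ-rankFin u)) (sym (toℕ-rankFin v)) (rank-mono (K-mono u≺v))
    }

  rank-between : ∀ {x y} → K x <ᶠ K y → rank y ≡ rank x + suc (count (K>? x ∩? K<? y))
  rank-between {x} {y} Kx<Ky = begin
    rank y
      ≡⟨ count-split (K<? y) (K≤? x) ⟩
    count (K<? y ∩? K≤? x) + count (K<? y ∩? ∁? (K≤? x))
      ≡⟨ cong₂ _+_ (count-cong (K<? y ∩? K≤? x) (K≤? x) proj₂ (λ Kw≤Kx → ≤-<-trans Kw≤Kx Kx<Ky , Kw≤Kx))
                   (count-cong (K<? y ∩? ∁? (K≤? x)) (K>? x ∩? K<? y)
                      (λ (Kw<Ky , Kw≰Kx) → ≰⇒> Kw≰Kx , Kw<Ky) (λ (Kx<Kw , Kw<Ky) → Kw<Ky , <⇒≱ Kx<Kw)) ⟩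
    count (K≤? x) + between
      ≡⟨ cong (_+ between) (count-split (K≤? x) (K<? x)) ⟩
    count (K≤? x ∩? K<? x) + count (K≤? x ∩? ∁? (K<? x)) + between
      ≡⟨ cong (_+ between) (cong₂ _+_
           (count-cong (K≤? x ∩? K<? x) (K<? x) proj₂ (λ Kw<Kx → <⇒≤ Kw<Kx , Kw<Kx))
           (trans (count-cong (K≤? x ∩? ∁? (K<? x)) (_≟ x) at-x (λ { refl → ≤-refl , <-irrefl refl }))
                  (count-singleton x))) ⟩
    rank x + 1 + between
      ≡⟨ +-assoc (rank x) 1 between ⟩
    rank x + suc between ∎
    where
    open ≡-Reasoning
    between : ℕ
    between = count (K>? x ∩? K<? y)
    at-x : ∀ {w} → K w ≤ᶠ K x × ¬ K w <ᶠ K x → w ≡ x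
    at-x (Kw≤Kx , Kw≮Kx) = K-injective (toℕ-injective (≤-antisym Kw≤Kx (≮⇒≥ Kw≮Kx)))

module Positions {n : ℕ} {_≺_ : Rel (Fin n) 0ℓ} (E : LinearExtension _≺_) where

  pos : Fin n → ℕ
  pos u = toℕ (L E u)

  count-≤-interval : ∀ {P : Pred (Fin n) p} (P? : Decidable P) {a b} →
                     (∀ {w} → P w → a ≤ pos w × pos w < b) → a ≤ b → b ≤ n → count P? + a ≤ b
  count-≤-interval P? {a} {b} P⇒in a≤b b≤n = begin
    count P? + a                 ≤⟨ +-monoˡ-≤ a (count-mono P? (interval? ∘ L E) P⇒in) ⟩
    count (interval? ∘ L E) + a  ≡⟨ cong (_+ a) (count-permute interval? (bijective E)) ⟩
    count interval? + a          ≡⟨ count-interval a≤b b≤n ⟩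
    b                            ∎
    where
    open ≤-Reasoning
    interval? : Decidable (λ (i : Fin n) → a ≤ toℕ i × toℕ i < b)
    interval? i = (a ≤? toℕ i) ×-dec (toℕ i <? b)

module Gap {n : ℕ} {_≺_ : Rel (Fin n) 0ℓ} (_≺?_ : Decidable₂ _≺_) (spo : IsStrictPartialOrder _≡_ _≺_)
           {x y : Fin n} (x≺y : x ≺ y) where

  open IsStrictPartialOrder spo using (irrefl; asym) renaming (trans to ≺-trans)

  x≢y : x ≢ y
  x≢y x≡y = irrefl x≡y x≺y

  below? : ∀ u → Decidable (_≺ u)
  below? u w = w ≺? u

  above? : ∀ u → Decidable (u ≺_)
  above? u w = u ≺? w

  inside? : Decidable (λ w → x ≺ w × w ≺ y)
  inside? w = (x ≺? w) ×-dec (w ≺? y)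

  f≡count : f _≺_ _≺?_ x ≡ count (below? x)
  f≡count = length-filter-tabulate (below? x) id

  g≡count : g _≺_ _≺?_ y ≡ count (above? y)
  g≡count = length-filter-tabulate (above? y) id

  h≡count : h _≺_ _≺?_ x y ≡ count inside?
  h≡count = length-filter-tabulate inside? id

  height : Fin n → Fin (suc n)
  height u = fromℕ< (s≤s (count-≤ (below? u)))

  height-mono : ∀ {u v} → u ≺ v → height u <ᶠ height v
  height-mono {u} {v} u≺v = subst₂ _<_ (sym (toℕ-fromℕ< _)) (sym (toℕ-fromℕ< _))
    (count-strict (below? u) (below? v) (λ w≺u → ≺-trans w≺u u≺v) u≺v (irrefl refl))

  M : ℕ
  M = suc n * n

  tiebreak : Fin n → Fin M
  tiebreak u = combine (height u) u

  tiebreak-mono : ∀ {u v} → u ≺ v → tiebreak u <ᶠ tiebreak v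
  tiebreak-mono u≺v = combine-monoˡ-< _ _ (height-mono u≺v)

  tiebreak-injective : ∀ {u v} → tiebreak u ≡ tiebreak v → u ≡ v
  tiebreak-injective {u} {v} = combine-injectiveʳ (height u) u (height v) v

  tiebreak+tiebreak<2M : ∀ u v → toℕ (tiebreak u) + suc (toℕ (tiebreak v)) < M + M
  tiebreak+tiebreak<2M u v = +-mono-<-≤ (toℕ<n (tiebreak u)) (toℕ<n (tiebreak v))

  Lower Upper Middle : ℕ → Pred (Fin n) 0ℓ
  Lower t u  = u ≺ x ⊎ (¬ x ≺ u × toℕ (tiebreak u) < t)
  Upper t u  = y ≺ u ⊎ (x ≺ u × ¬ u ≺ y × M + M ≤ toℕ (tiebreak u) + t)
  Middle t u = u ≢ x × u ≢ y × ¬ Lower t u × ¬ Upper t u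

  Lower? : ∀ t → Decidable (Lower t)
  Lower? t u = (u ≺? x) ⊎-dec (¬? (x ≺? u) ×-dec (toℕ (tiebreak u) <? t))

  Upper? : ∀ t → Decidable (Upper t)
  Upper? t u = (y ≺? u) ⊎-dec ((x ≺? u) ×-dec ¬? (u ≺? y) ×-dec (M + M ≤? toℕ (tiebreak u) + t))

  Middle? : ∀ t → Decidable (Middle t)
  Middle? t u = ¬? (u ≟ x) ×-dec ¬? (u ≟ y) ×-dec ¬? (Lower? t u) ×-dec ¬? (Upper? t u)

  Lower-closed : ∀ {t u v} → u ≺ v → Lower t v → Lower t u
  Lower-closed u≺v (inj₁ v≺x)         = inj₁ (≺-trans u≺v v≺x)
  Lower-closed u≺v (inj₂ (x⊀v , v<t)) = inj₂ ((λ x≺u → x⊀v (≺-trans x≺u u≺v)) , <-trans (tiebreak-mono u≺v) v<t)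

  Upper-closed : ∀ {t u v} → u ≺ v → Upper t u → Upper t v
  Upper-closed u≺v (inj₁ y≺u)                   = inj₁ (≺-trans y≺u u≺v)
  Upper-closed u≺v (inj₂ (x≺u , u⊀y , 2M≤u+t)) =
    inj₂ (≺-trans x≺u u≺v , u⊀y ∘ ≺-trans u≺v , ≤-trans 2M≤u+t (+-monoˡ-≤ _ (<⇒≤ (tiebreak-mono u≺v))))

  Upper⇒above-x : ∀ {t u} → Upper t u → x ≺ u
  Upper⇒above-x (inj₁ y≺u)       = ≺-trans x≺y y≺u
  Upper⇒above-x (inj₂ (x≺u , _)) = x≺u

  Upper⇒not-below-y : ∀ {t u} → Upper t u → ¬ u ≺ y
  Upper⇒not-below-y (inj₁ y≺u)           = asym y≺u
  Upper⇒not-below-y (inj₂ (_ , u⊀y , _)) = u⊀y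

  above-x⇒not-Lower : ∀ {t u} → x ≺ u → ¬ Lower t u
  above-x⇒not-Lower x≺u (inj₁ u≺x)       = asym x≺u u≺x
  above-x⇒not-Lower x≺u (inj₂ (x⊀u , _)) = x⊀u x≺u

  data Placement (t : ℕ) (u : Fin n) : Fin 5 → Set where
    lower  : Lower t u  → Placement t u 0F
    at-x   : u ≡ x      → Placement t u 1F
    middle : Middle t u → Placement t u 2F
    at-y   : u ≡ y      → Placement t u 3F
    upper  : Upper t u  → Placement t u 4F

  -- x and y are tested first: x may satisfy Lower, and y may satisfy Upper.
  place : ∀ t u → Σ (Fin 5) (Placement t u)
  place t u with u ≟ x | u ≟ y | Lower? t u | Upper? t u
  ... | yes u≡x | _       | _     | _      = 1F , at-x u≡x
  ... | no _    | yes u≡y | _     | _      = 3F , at-y u≡y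
  ... | no _    | no _    | yes l | _      = 0F , lower l
  ... | no _    | no _    | no _  | yes up = 4F , upper up
  ... | no u≢x  | no u≢y  | no ¬l | no ¬up = 2F , middle (u≢x , u≢y , ¬l , ¬up)

  level : ℕ → Fin n → Fin 5
  level t u = proj₁ (place t u)

  level-x : ∀ t → level t x ≡ 1F
  level-x t with x ≟ x
  ... | yes _  = refl
  ... | no x≢x = contradiction refl x≢x

  level-y : ∀ t → level t y ≡ 3F
  level-y t with y ≟ x | y ≟ y
  ... | yes y≡x | _      = contradiction (sym y≡x) x≢y
  ... | no _    | yes _  = refl
  ... | no _    | no y≢y = contradiction refl y≢y

  level-middle : ∀ {t w} → Middle t w → level t w ≡ 2F
  level-middle {t} {w} (w≢x , w≢y , ¬Lw , ¬Uw) with place t w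
  ... | _ , lower Lw = contradiction Lw ¬Lw
  ... | _ , at-x w≡x = contradiction w≡x w≢x
  ... | _ , middle _ = refl
  ... | _ , at-y w≡y = contradiction w≡y w≢y
  ... | _ , upper Uw = contradiction Uw ¬Uw

  level-mono : ∀ t {u v} → u ≺ v → level t u ≤ᶠ level t v
  level-mono t {u} {v} u≺v with place t u | place t v
  ... | _ , lower _                  | _                     = z≤n
  ... | _ , at-x refl                | _ , lower Lv          = contradiction Lv (above-x⇒not-Lower u≺v)
  ... | _ , at-x _                   | suc _ , _             = s≤s z≤n
  ... | _ , middle (_ , _ , ¬Lu , _) | _ , lower Lv          = contradiction (Lower-closed u≺v Lv) ¬Lu
  ... | _ , middle (_ , _ , ¬Lu , _) | _ , at-x refl         = contradiction (inj₁ u≺v) ¬Lu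
  ... | _ , middle _                 | suc (suc _) , _       = s≤s (s≤s z≤n)
  ... | _ , at-y refl                | _ , lower Lv          = contradiction Lv (above-x⇒not-Lower (≺-trans x≺y u≺v))
  ... | _ , at-y refl                | _ , at-x refl         = contradiction u≺v (asym x≺y)
  ... | _ , at-y refl                | _ , middle (_ , _ , _ , ¬Uv) = contradiction (inj₁ u≺v) ¬Uv
  ... | _ , at-y _                   | suc (suc (suc _)) , _ = s≤s (s≤s (s≤s z≤n))
  ... | _ , upper Uu                 | _ , lower Lv          =
    contradiction Lv (above-x⇒not-Lower (Upper⇒above-x (Upper-closed u≺v Uu)))
  ... | _ , upper Uu                 | _ , at-x refl         =
    contradiction (Upper⇒above-x (Upper-closed u≺v Uu)) (irrefl refl)
  ... | _ , upper Uu                 | _ , middle (_ , _ , _ , ¬Uv) = contradiction (Upper-closed u≺v Uu) ¬Uv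
  ... | _ , upper Uu                 | _ , at-y refl         = contradiction u≺v (Upper⇒not-below-y Uu)
  ... | _ , upper _                  | _ , upper _           = ≤-refl

  key : ℕ → Fin n → Fin (5 * M)
  key t u = combine (level t u) (tiebreak u)

  key-mono : ∀ t {u v} → u ≺ v → key t u <ᶠ key t v
  key-mono t {u} {v} u≺v =
    combine-lex-< {a = tiebreak u} {b = tiebreak v} (level-mono t u≺v) (λ _ → tiebreak-mono u≺v)

  key-injective : ∀ t {u v} → key t u ≡ key t v → u ≡ v
  key-injective t {u} {v} = tiebreak-injective ∘ combine-injectiveʳ (level t u) (tiebreak u) (level t v) (tiebreak v)

  key-<⇒level-≤ : ∀ {t u v} → key t u <ᶠ key t v → level t u ≤ᶠ level t v
  key-<⇒level-≤ {t} {u} {v} ku<kv =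
    ≮⇒≥ (λ lv<lu → <-asym ku<kv (combine-monoˡ-< (tiebreak v) (tiebreak u) lv<lu))

  module At (t : ℕ) = Ranking (key t) (λ {u v} → key-injective t {u} {v}) (λ {u v} → key-mono t {u} {v})

  Placement-inner⇒Middle : ∀ {t w i} → Placement t w i → 1 ≤ toℕ i → toℕ i ≤ 3 → w ≢ x → w ≢ y → Middle t w
  Placement-inner⇒Middle (lower _)   ()
  Placement-inner⇒Middle (at-x w≡x)  _ _ w≢x _   = contradiction w≡x w≢x
  Placement-inner⇒Middle (middle Mw) _ _ _   _   = Mw
  Placement-inner⇒Middle (at-y w≡y)  _ _ _   w≢y = contradiction w≡y w≢y
  Placement-inner⇒Middle (upper _)   _ (s≤s (s≤s (s≤s ()))) _ _

  Middle⇒between : ∀ {t w} → Middle t w → key t x <ᶠ key t w × key t w <ᶠ key t y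
  Middle⇒between {t} {w} Mw =
      combine-monoˡ-< (tiebreak x) (tiebreak w)
        (subst₂ _<ᶠ_ (sym (level-x t)) (sym (level-middle Mw)) (s≤s (s≤s z≤n)))
    , combine-monoˡ-< (tiebreak w) (tiebreak y)
        (subst₂ _<ᶠ_ (sym (level-middle Mw)) (sym (level-y t)) (s≤s (s≤s (s≤s z≤n))))

  between⇒Middle : ∀ {t w} → key t x <ᶠ key t w → key t w <ᶠ key t y → Middle t w
  between⇒Middle {t} {w} x<w w<y = Placement-inner⇒Middle (proj₂ (place t w))
    (subst (_≤ᶠ level t w) (level-x t) (key-<⇒level-≤ {t} {x} {w} x<w))
    (subst (level t w ≤ᶠ_) (level-y t) (key-<⇒level-≤ {t} {w} {y} w<y))
    (λ w≡x → <-irrefl (cong (toℕ ∘ key t) (sym w≡x)) x<w)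
    (λ w≡y → <-irrefl (cong (toℕ ∘ key t) w≡y) w<y)

  middleCount : ℕ → ℕ
  middleCount t = count (Middle? t)

  diff-At : ∀ t → diff (At.rankExtension t) x y ≡ + suc (middleCount t)
  diff-At t = begin
    + toℕ (rankFin y) - + toℕ (rankFin x)
      ≡⟨ cong₂ (λ a b → + a - + b) (toℕ-rankFin y) (toℕ-rankFin x) ⟩
    + rank y - + rank x
      ≡⟨ cong (λ r → + r - + rank x) (rank-between {x} {y} (key-mono t x≺y)) ⟩
    + (rank x + suc (count (K>? x ∩? K<? y))) - + rank x
      ≡⟨ +[m+n]-+m≡+n (rank x) _ ⟩
    + suc (count (K>? x ∩? K<? y))
      ≡⟨ cong (+_ ∘ suc) (count-cong (K>? x ∩? K<? y) (Middle? t)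
           (λ {w} (x<w , w<y) → between⇒Middle {t} {w} x<w w<y) (λ {w} → Middle⇒between {t} {w})) ⟩
    + suc (middleCount t) ∎
    where
    open ≡-Reasoning
    open At t

  entering-Lower : ∀ {t w} → Lower (suc t) w → ¬ Lower t w → toℕ (tiebreak w) ≡ t
  entering-Lower (inj₁ w≺x)            ¬Lw = contradiction (inj₁ w≺x) ¬Lw
  entering-Lower (inj₂ (x⊀w , w<1+t)) ¬Lw = ≤-antisym (≤-pred w<1+t) (≮⇒≥ (λ w<t → ¬Lw (inj₂ (x⊀w , w<t))))

  entering-Upper : ∀ {t w} → Upper (suc t) w → ¬ Upper t w → toℕ (tiebreak w) + suc t ≡ M + M
  entering-Upper (inj₁ y≺w) ¬Uw = contradiction (inj₁ y≺w) ¬Uw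
  entering-Upper {t} (inj₂ (x≺w , w⊀y , 2M≤w+1+t)) ¬Uw =
    ≤-antisym (≤-trans (≤-reflexive (+-suc _ t)) (≰⇒> (λ 2M≤w+t → ¬Uw (inj₂ (x≺w , w⊀y , 2M≤w+t))))) 2M≤w+1+t

  leaving-Middle : ∀ {t w} → Middle t w → ¬ Middle (suc t) w →
                   toℕ (tiebreak w) ≡ t ⊎ toℕ (tiebreak w) + suc t ≡ M + M
  leaving-Middle {t} {w} (w≢x , w≢y , ¬Lw , ¬Uw) ¬M′w with Lower? (suc t) w | Upper? (suc t) w
  ... | yes L′w | _       = inj₁ (entering-Lower L′w ¬Lw)
  ... | no _    | yes U′w = inj₂ (entering-Upper U′w ¬Uw)
  ... | no ¬L′w | no ¬U′w = contradiction (w≢x , w≢y , ¬L′w , ¬U′w) ¬M′w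

  leaving-Middle-unique : ∀ {t u v} → Middle t u × ¬ Middle (suc t) u → Middle t v × ¬ Middle (suc t) v → u ≡ v
  leaving-Middle-unique {t} {u} {v} (Mu , ¬M′u) (Mv , ¬M′v) with leaving-Middle Mu ¬M′u | leaving-Middle Mv ¬M′v
  ... | inj₁ u≡t | inj₁ v≡t = tiebreak-injective (toℕ-injective (trans u≡t (sym v≡t)))
  ... | inj₂ u≡  | inj₂ v≡  = tiebreak-injective (toℕ-injective (+-cancelʳ-≡ _ _ _ (trans u≡ (sym v≡))))
  ... | inj₁ u≡t | inj₂ v≡  =
    contradiction (trans (cong (λ s → toℕ (tiebreak v) + suc s) u≡t) v≡) (<⇒≢ (tiebreak+tiebreak<2M v u))
  ... | inj₂ u≡  | inj₁ v≡t =
    contradiction (trans (cong (λ s → toℕ (tiebreak u) + suc s) v≡t) u≡) (<⇒≢ (tiebreak+tiebreak<2M u v))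

  middleCount-step : ∀ t → middleCount t ≤ suc (middleCount (suc t))
  middleCount-step t = begin
    middleCount t
      ≡⟨ count-split (Middle? t) (Middle? (suc t)) ⟩
    count (Middle? t ∩? Middle? (suc t)) + count (Middle? t ∩? ∁? (Middle? (suc t)))
      ≤⟨ +-mono-≤ (count-mono (Middle? t ∩? Middle? (suc t)) (Middle? (suc t)) proj₂)
                  (count-≤1 (Middle? t ∩? ∁? (Middle? (suc t))) (leaving-Middle-unique {t})) ⟩
    middleCount (suc t) + 1
      ≡⟨ +-comm (middleCount (suc t)) 1 ⟩
    suc (middleCount (suc t)) ∎
    where open ≤-Reasoning

  Forced : Pred (Fin n) 0ℓ
  Forced w = w ≺ x ⊎ w ≡ x ⊎ w ≡ y ⊎ y ≺ w

  Forced? : Decidable Forced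
  Forced? = below? x ∪? (_≟ x) ∪? (_≟ y) ∪? above? y

  unforced⇒Middle-initially : ∀ {w} → ¬ Forced w → Middle 0 w
  unforced⇒Middle-initially {w} ¬Fw =
      ¬Fw ∘ inj₂ ∘ inj₁
    , ¬Fw ∘ inj₂ ∘ inj₂ ∘ inj₁
    , (λ { (inj₁ w≺x) → ¬Fw (inj₁ w≺x) ; (inj₂ (_ , ())) })
    , (λ { (inj₁ y≺w)           → ¬Fw (inj₂ (inj₂ (inj₂ y≺w)))
         ; (inj₂ (_ , _ , 2M≤w)) → <⇒≱ (<-≤-trans (toℕ<n (tiebreak w)) (m≤m+n M M))
                                       (≤-trans 2M≤w (≤-reflexive (+-identityʳ _))) })

  count-Forced : count Forced? ≤ count (below? x) + (1 + (1 + count (above? y)))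
  count-Forced = begin
    count Forced?
      ≤⟨ count-∪ (below? x) ≡x∨≡y∨above? ⟩
    count (below? x) + count ≡x∨≡y∨above?
      ≤⟨ +-monoʳ-≤ (count (below? x)) (≤-trans (count-∪ (_≟ x) ≡y∨above?)
                                              (+-monoʳ-≤ (count (_≟ x)) (count-∪ (_≟ y) (above? y)))) ⟩
    count (below? x) + (count (_≟ x) + (count (_≟ y) + count (above? y)))
      ≡⟨ cong₂ (λ a b → count (below? x) + (a + (b + count (above? y)))) (count-singleton x) (count-singleton y) ⟩
    count (below? x) + (1 + (1 + count (above? y))) ∎
    where
    open ≤-Reasoning
    ≡y∨above? : Decidable (λ w → w ≡ y ⊎ y ≺ w)
    ≡y∨above? = (_≟ y) ∪? above? y
    ≡x∨≡y∨above? : Decidable (λ w → w ≡ x ⊎ w ≡ y ⊎ y ≺ w)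
    ≡x∨≡y∨above? = (_≟ x) ∪? ≡y∨above?

  middleCount-initial : n ≤ 2 + middleCount 0 + count (above? y) + count (below? x)
  middleCount-initial = begin
    n
      ≡⟨ count-complement Forced? ⟨
    count Forced? + count (∁? Forced?)
      ≤⟨ +-mono-≤ count-Forced (count-mono (∁? Forced?) (Middle? 0) unforced⇒Middle-initially) ⟩
    count (below? x) + (1 + (1 + count (above? y))) + middleCount 0
      ≡⟨ rearrange (count (below? x)) (count (above? y)) (middleCount 0) ⟩
    2 + middleCount 0 + count (above? y) + count (below? x) ∎
    where
    open ≤-Reasoning
    rearrange : ∀ a b d → a + (1 + (1 + b)) + d ≡ 2 + d + b + a
    rearrange = solve-∀

  ≤-middleCount-initial : ∀ {m} → suc m + count (above? y) + count (below? x) < n → m ≤ middleCount 0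
  ≤-middleCount-initial bound =
    ≤-pred (≤-pred (+-cancelʳ-≤ _ _ _ (+-cancelʳ-≤ _ _ _ (≤-trans bound middleCount-initial))))

  Middle-finally⇒inside : ∀ {w} → Middle (M + M) w → x ≺ w × w ≺ y
  Middle-finally⇒inside {w} (_ , _ , ¬Lw , ¬Uw) = x≺w , w≺y
    where
    x≺w : x ≺ w
    x≺w = decidable-stable (x ≺? w) (λ x⊀w → ¬Lw (inj₂ (x⊀w , <-≤-trans (toℕ<n (tiebreak w)) (m≤m+n M M))))
    w≺y : w ≺ y
    w≺y = decidable-stable (w ≺? y) (λ w⊀y → ¬Uw (inj₂ (x≺w , w⊀y , m≤n+m (M + M) (toℕ (tiebreak w)))))

  middleCount-final : middleCount (M + M) ≤ count inside?
  middleCount-final = count-mono (Middle? (M + M)) inside? Middle-finally⇒inside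

  extension-with-gap : ∀ c → h _≺_ _≺?_ x y < c → c + g _≺_ _≺?_ y + f _≺_ _≺?_ x < n →
                       Σ (LinearExtension _≺_) (λ E → diff E x y ≡ + c)
  extension-with-gap (suc m) h<1+m 1+m+g+f<n
    rewrite f≡count | g≡count | h≡count
    with s≤s h≤m ← h<1+m
    with t , middle≡m ← discrete-ivt middleCount middleCount-step (M + M)
                          (≤-trans middleCount-final h≤m) (≤-middleCount-initial 1+m+g+f<n)
    = At.rankExtension t , trans (diff-At t) (cong (+_ ∘ suc) middle≡m)

  gap-bounds : (E : LinearExtension _≺_) →
               Σ ℕ λ c → diff E x y ≡ + c × h _≺_ _≺?_ x y < c × c + g _≺_ _≺?_ y + f _≺_ _≺?_ x < n
  gap-bounds E rewrite f≡count | g≡count | h≡count = c , diff≡c , h<c , c+g+f<n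
    where
    open Positions E
    px<py : pos x < pos y
    px<py = monotone E x≺y
    c : ℕ
    c = pos y ∸ pos x
    px+c≡py : pos x + c ≡ pos y
    px+c≡py = m+[n∸m]≡n (<⇒≤ px<py)
    f≤px : count (below? x) ≤ pos x
    f≤px = subst (_≤ pos x) (+-identityʳ _)
             (count-≤-interval (below? x) (λ w≺x → z≤n , monotone E w≺x) z≤n (<⇒≤ (toℕ<n (L E x))))
    h+px<py : count inside? + suc (pos x) ≤ pos y
    h+px<py = count-≤-interval inside? (λ (x≺w , w≺y) → monotone E x≺w , monotone E w≺y)
                px<py (<⇒≤ (toℕ<n (L E y)))
    g+py<n : count (above? y) + suc (pos y) ≤ n
    g+py<n = count-≤-interval (above? y) (λ {w} y≺w → monotone E y≺w , toℕ<n (L E w)) (toℕ<n (L E y)) ≤-refl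
    diff≡c : diff E x y ≡ + c
    diff≡c = trans (cong (λ p → + p - + pos x) (sym px+c≡py)) (+[m+n]-+m≡+n (pos x) c)
    h<c : count inside? < c
    h<c = +-cancelʳ-≤ (pos x) _ c (begin
      suc (count inside?) + pos x   ≡⟨ +-suc (count inside?) (pos x) ⟨
      count inside? + suc (pos x)   ≤⟨ h+px<py ⟩
      pos y                         ≡⟨ px+c≡py ⟨
      pos x + c                     ≡⟨ +-comm (pos x) c ⟩
      c + pos x                     ∎)
      where open ≤-Reasoning
    c+g+f<n : c + count (above? y) + count (below? x) < n
    c+g+f<n = begin-strict
      c + count (above? y) + count (below? x)  ≤⟨ +-monoʳ-≤ (c + count (above? y)) f≤px ⟩
      c + count (above? y) + pos x             ≡⟨ rearrange c (count (above? y)) (pos x) ⟩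
      count (above? y) + (pos x + c)           ≡⟨ cong (λ p → count (above? y) + p) px+c≡py ⟩
      count (above? y) + pos y                 <⟨ +-monoʳ-< (count (above? y)) (n<1+n (pos y)) ⟩
      count (above? y) + suc (pos y)           ≤⟨ g+py<n ⟩
      n                                        ∎
      where
      open ≤-Reasoning
      rearrange : ∀ a b d → a + b + d ≡ b + (d + a)
      rearrange = solve-∀

theorem8p5 : (n : ℕ) (_≺_ : Rel (Fin n) 0ℓ) (_≺?_ : Decidable₂ _≺_)
    → IsStrictPartialOrder _≡_ _≺_
    → (x y : Fin n) → x ≺ y → (k : ℤ)
    → (Σ (LinearExtension _≺_) (λ E → diff E x y ≡ k))
      ⇔ ((+ h _≺_ _≺?_ x y ℤ.< k) × (k ℤ.< + n - + f _≺_ _≺?_ x - + g _≺_ _≺?_ y))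
theorem8p5 n _≺_ _≺?_ spo x y x≺y k = ⇔-trans
  (mk⇔ (λ { (E , refl) → gap-bounds E })
       (λ { (m , refl , h<m , m+g+f<n) → extension-with-gap m h<m m+g+f<n }))
  (⇔-sym (window-ℤ⇔ℕ (h _≺_ _≺?_ x y) (f _≺_ _≺?_ x) (g _≺_ _≺?_ y)))
  where open Gap _≺?_ spo x≺y
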